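{- For every integer $n \geq 3$ and every integer $i$ with $0 \leq i \leq n-3$, $x_{n + i} + x_{n - i - 2} \geq x_{n + i - 2} + x_{n - i}$.
   Context: The sequence $(x_n)_{n\ge1}$ is defined by $x_1 = 0, x_2 = 1, x_3 = 2, x_4 = 4, x_5 = 5$ and, for $n \geq 6$, $$x_n = (n - 1) + \begin{cases} x_{\frac{n + 1}{2}} + x_{\frac{n - 3}{2}}, & n \equiv 1 \pmod 4,\\ 2 x_{\frac{n - 1}{2}}, & n \equiv 3 \pmod 4,\\ x_{\frac{n}{2}} + x_{\frac{n - 2}{2}}, & n \text{ even}. \end{cases}$$ -}

module Defs where

open import Data.Nat using (ℕ; zero; suc; _+_; _*_; _∸_; _<_; _≤_; _≥_; s≤s; z≤n; _/_; _%_)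
open import Data.Nat.Properties using (_<?_)
open import Data.Nat.Induction using (<-rec)
open import Relation.Nullary using (yes; no)

-- One step of the recursion: given the values x_m for all m < n, compute x_n.
-- Indices are the paper's (1-based); x 0 is a junk value (0) and is never used
-- by the recursion for n ≥ 1.
step : (n : ℕ) → ({m : ℕ} → m < n → ℕ) → ℕ
step 0 rec = 0
step 1 rec = 0
step 2 rec = 1
step 3 rec = 2
step 4 rec = 4
step 5 rec = 5
step n@(suc (suc (suc (suc (suc (suc k)))))) rec = (n ∸ 1) + branch (n % 4)
  where
  -- safe lookup: returns rec m if m < n (always the case for the indices used, n ≥ 6)
  get : ℕ → ℕ
  get m with m <? n
  ... | yes p = rec {m} p
  ... | no _ = 0
  branch : ℕ → ℕ
  branch 1 = get ((n + 1) / 2) + get ((n ∸ 3) / 2)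
  branch 3 = 2 * get ((n ∸ 1) / 2)
  branch _ = get (n / 2) + get ((n ∸ 2) / 2)

x : ℕ → ℕ
x = <-rec (λ _ → ℕ) step

-- The two-step gap x (m + 2) − x m is nondecreasing in m ≥ 1; the theorem is this
-- monotonicity between m = n − i − 2 and m = n + i − 2. Unfolding the recursion twice
-- shows that for m ≥ 6 the gap at m exceeds by exactly 2 the gap at h m, where
-- h (4j+6) = 2j+2 and h (4j+7) = h (4j+8) = h (4j+9) = 2j+3. Since h is nondecreasing
-- with steps 0 or 1, comparing the gaps at m and m + 1 reduces to comparing them at
-- h m and h (m + 1), so strong induction on m, from the values x 1 … x 8, proves it.
module Submission where

open import Defs
open import Data.Nat
open import Data.Nat.Properties
open import Data.Nat.DivMod
open import Data.Nat.Divisibility using (divides-refl)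
open import Data.Nat.Induction using (<-rec; <-wellFounded)
open import Data.Nat.Tactic.RingSolver using (solve-∀)
open import Data.Fin using (zero; suc)
open import Data.Bool using (T)
open import Data.Empty using (⊥-elim)
open import Induction.WellFounded using (module FixPoint)
open import Relation.Binary.PropositionalEquality
open import Relation.Nullary using (yes; no; contradiction)
open import Function using (_$_)

Rec : ℕ → Set
Rec n = {m : ℕ} → m < n → ℕ

-- Replicas of the local functions get and branch of step.
lookup< : (n : ℕ) → Rec n → ℕ → ℕ
lookup< n rec m with m <? n
... | yes m<n = rec m<n
... | no _ = 0

branch< : (n : ℕ) → Rec n → ℕ → ℕ
branch< n rec 1 = lookup< n rec ((n + 1) / 2) + lookup< n rec ((n ∸ 3) / 2)
branch< n rec 3 = 2 * lookup< n rec ((n ∸ 1) / 2)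
branch< n rec _ = lookup< n rec (n / 2) + lookup< n rec ((n ∸ 2) / 2)

step-6+ : ∀ k (rec : Rec (6 + k)) →
          step (6 + k) rec ≡ 5 + k + branch< (6 + k) rec ((6 + k) % 4)
step-6+ k rec with (6 + k) % 4
... | 1 with (6 + k + 1) / 2 <? 6 + k | (6 + k ∸ 3) / 2 <? 6 + k
...   | yes _ | yes _ = refl
...   | yes _ | no _  = refl
...   | no _  | yes _ = refl
...   | no _  | no _  = refl
step-6+ k rec | 3 with (6 + k ∸ 1) / 2 <? 6 + k
...   | yes _ = refl
...   | no _  = refl
step-6+ k rec | 0 with (6 + k) / 2 <? 6 + k | (6 + k ∸ 2) / 2 <? 6 + k
...   | yes _ | yes _ = refl
...   | yes _ | no _  = refl
...   | no _  | yes _ = refl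
...   | no _  | no _  = refl
step-6+ k rec | 2 with (6 + k) / 2 <? 6 + k | (6 + k ∸ 2) / 2 <? 6 + k
...   | yes _ | yes _ = refl
...   | yes _ | no _  = refl
...   | no _  | yes _ = refl
...   | no _  | no _  = refl
step-6+ k rec | suc (suc (suc (suc _)))
  with (6 + k) / 2 <? 6 + k | (6 + k ∸ 2) / 2 <? 6 + k
...   | yes _ | yes _ = refl
...   | yes _ | no _  = refl
...   | no _  | yes _ = refl
...   | no _  | no _  = refl

module _ {n : ℕ} {rec rec′ : Rec n} (rec≗rec′ : ∀ {m} (m<n : m < n) → rec m<n ≡ rec′ m<n) where

  lookup<-cong : ∀ m → lookup< n rec m ≡ lookup< n rec′ m
  lookup<-cong m with m <? n
  ... | yes m<n = rec≗rec′ m<n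
  ... | no _ = refl

  branch<-cong : ∀ r → branch< n rec r ≡ branch< n rec′ r
  branch<-cong 0 = cong₂ _+_ (lookup<-cong _) (lookup<-cong _)
  branch<-cong 1 = cong₂ _+_ (lookup<-cong _) (lookup<-cong _)
  branch<-cong 2 = cong₂ _+_ (lookup<-cong _) (lookup<-cong _)
  branch<-cong 3 = cong (2 *_) (lookup<-cong _)
  branch<-cong (suc (suc (suc (suc _)))) = cong₂ _+_ (lookup<-cong _) (lookup<-cong _)

step-cong : ∀ n {rec rec′ : Rec n} → (∀ {m} (m<n : m < n) → rec m<n ≡ rec′ m<n) →
            step n rec ≡ step n rec′
step-cong 0 _ = refl
step-cong 1 _ = refl
step-cong 2 _ = refl
step-cong 3 _ = refl
step-cong 4 _ = refl
step-cong 5 _ = refl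
step-cong (suc (suc (suc (suc (suc (suc k)))))) {rec} {rec′} rec≗rec′ = begin
  step (6 + k) rec               ≡⟨ step-6+ k rec ⟩
  5 + k + branch< (6 + k) rec r  ≡⟨ cong (5 + k +_) (branch<-cong rec≗rec′ r) ⟩
  5 + k + branch< (6 + k) rec′ r ≡⟨ step-6+ k rec′ ⟨
  step (6 + k) rec′              ∎
  where
  open ≡-Reasoning
  r : ℕ
  r = (6 + k) % 4

open FixPoint <-wellFounded (λ _ → ℕ) step step-cong using (unfold-wfRec)

x< : ∀ {n} → Rec n
x< {m = m} _ = x m

x-6+ : ∀ k → x (6 + k) ≡ 5 + k + branch< (6 + k) x< ((6 + k) % 4)
x-6+ k = trans (unfold-wfRec {6 + k}) (step-6+ k x<)

lookup<-x : ∀ {n m} → m < n → lookup< n x< m ≡ x m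
lookup<-x {n} {m} m<n with m <? n
... | yes _ = refl
... | no m≮n = ⊥-elim (m≮n m<n)

+-*2<+-*4 : ∀ {a b} j → a < b → a + j * 2 < b + j * 4
+-*2<+-*4 j a<b = +-mono-<-≤ a<b (*-monoʳ-≤ j (s≤s (s≤s z≤n)))

[m+j*4]/2≡m/2+j*2 : ∀ m j → (m + j * 4) / 2 ≡ m / 2 + j * 2
[m+j*4]/2≡m/2+j*2 m j = begin
  (m + j * 4) / 2      ≡⟨ /-congˡ (cong (m +_) (*-assoc j 2 2)) ⟨
  (m + j * 2 * 2) / 2  ≡⟨ +-distrib-/-∣ʳ m (divides-refl (j * 2)) ⟩
  m / 2 + j * 2 * 2 / 2 ≡⟨ cong (m / 2 +_) (m*n/n≡m (j * 2) 2) ⟩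
  m / 2 + j * 2        ∎
  where open ≡-Reasoning

x-residue : ∀ c j → x (6 + c + j * 4) ≡ 5 + c + j * 4 + branch< (6 + c + j * 4) x< ((6 + c) % 4)
x-residue c j = trans (x-6+ (c + j * 4))
  (cong (λ r → 5 + c + j * 4 + branch< (6 + c + j * 4) x< r) ([m+kn]%n≡m%n (6 + c) j 4))

lookup<-half : ∀ m c j {m/2<c : T (m / 2 <ᵇ c)} →
               lookup< (c + j * 4) x< ((m + j * 4) / 2) ≡ x (m / 2 + j * 2)
lookup<-half m c j {m/2<c} = trans (cong (lookup< (c + j * 4) x<) ([m+j*4]/2≡m/2+j*2 m j))
                                   (lookup<-x (+-*2<+-*4 j (<ᵇ⇒< (m / 2) c m/2<c)))

x[6+4j] : ∀ j → x (6 + j * 4) ≡ 5 + j * 4 + (x (3 + j * 2) + x (2 + j * 2))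
x[6+4j] j = trans (x-residue 0 j)
  (cong (5 + j * 4 +_) (cong₂ _+_ (lookup<-half 6 6 j) (lookup<-half 4 6 j)))

x[7+4j] : ∀ j → x (7 + j * 4) ≡ 6 + j * 4 + 2 * x (3 + j * 2)
x[7+4j] j = trans (x-residue 1 j) (cong (λ v → 6 + j * 4 + 2 * v) (lookup<-half 6 7 j))

x[8+4j] : ∀ j → x (8 + j * 4) ≡ 7 + j * 4 + (x (4 + j * 2) + x (3 + j * 2))
x[8+4j] j = trans (x-residue 2 j)
  (cong (7 + j * 4 +_) (cong₂ _+_ (lookup<-half 8 8 j) (lookup<-half 6 8 j)))

x[9+4j] : ∀ j → x (9 + j * 4) ≡ 8 + j * 4 + (x (5 + j * 2) + x (3 + j * 2))
x[9+4j] j = trans (x-residue 3 j)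
  (cong (8 + j * 4 +_) (cong₂ _+_ lookup<-[n+1]/2 (lookup<-half 6 9 j)))
  where
  lookup<-[n+1]/2 : lookup< (9 + j * 4) x< ((9 + j * 4 + 1) / 2) ≡ x (5 + j * 2)
  lookup<-[n+1]/2 = trans (cong (λ m → lookup< (9 + j * 4) x< (m / 2)) (+-comm (9 + j * 4) 1))
                          (lookup<-half 10 9 j)

-- a ≼ b says that x (2 + a) − x a ≤ x (2 + b) − x b, with the subtractions moved across.
infix 4 _≼_
record _≼_ (a b : ℕ) : Set where
  constructor gap≤
  field gap-≤ : x b + x (2 + a) ≤ x (2 + b) + x a

record GapShift (a a′ : ℕ) : Set where
  constructor shift
  field shift-≡ : x (2 + a) + x a′ ≡ 2 + x (2 + a′) + x a

≼-refl : ∀ {a} → a ≼ a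
≼-refl {a} = gap≤ (≤-reflexive (+-comm (x a) (x (2 + a))))

≼-trans : ∀ {a b c} → a ≼ b → b ≼ c → a ≼ c
≼-trans {a} {b} {c} (gap≤ a≼b) (gap≤ b≼c) =
  gap≤ $ +-cancelʳ-≤ (x b + x (2 + b)) (x c + x (2 + a)) (x (2 + c) + x a) $ begin
  x c + x (2 + a) + (x b + x (2 + b))        ≡⟨ regroup (x c) (x (2 + a)) (x b) (x (2 + b)) ⟩
  (x b + x (2 + a)) + (x c + x (2 + b))      ≤⟨ +-mono-≤ a≼b b≼c ⟩
  (x (2 + b) + x a) + (x (2 + c) + x b)      ≡⟨ regroup′ (x (2 + b)) (x a) (x (2 + c)) (x b) ⟩
  x (2 + c) + x a + (x b + x (2 + b))        ∎
  where
  open ≤-Reasoning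
  regroup : ∀ p q r s → p + q + (r + s) ≡ (r + q) + (p + s)
  regroup = solve-∀
  regroup′ : ∀ p q r s → (p + q) + (r + s) ≡ r + q + (s + p)
  regroup′ = solve-∀

≼-transfer : ∀ {a a′ b b′} → GapShift a a′ → GapShift b b′ → a′ ≼ b′ → a ≼ b
≼-transfer {a} {a′} {b} {b′} (shift shiftᵃ) (shift shiftᵇ) (gap≤ a′≼b′) =
  gap≤ $ +-cancelʳ-≤ (x a′ + x b′) (x b + x (2 + a)) (x (2 + b) + x a) $ begin
  x b + x (2 + a) + (x a′ + x b′)              ≡⟨ regroup (x b) (x (2 + a)) (x a′) (x b′) ⟩
  x b + x b′ + (x (2 + a) + x a′)              ≡⟨ cong (x b + x b′ +_) shiftᵃ ⟩
  x b + x b′ + (2 + x (2 + a′) + x a)          ≡⟨ regroup′ (x b) (x b′) (x (2 + a′)) (x a) ⟩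
  (x b′ + x (2 + a′)) + (2 + x a + x b)        ≤⟨ +-monoˡ-≤ (2 + x a + x b) a′≼b′ ⟩
  (x (2 + b′) + x a′) + (2 + x a + x b)        ≡⟨ regroup″ (x (2 + b′)) (x a′) (x a) (x b) ⟩
  x a + x a′ + (2 + x (2 + b′) + x b)          ≡⟨ cong (x a + x a′ +_) shiftᵇ ⟨
  x a + x a′ + (x (2 + b) + x b′)              ≡⟨ regroup‴ (x a) (x a′) (x (2 + b)) (x b′) ⟩
  x (2 + b) + x a + (x a′ + x b′)              ∎
  where
  open ≤-Reasoning
  regroup : ∀ p q r s → p + q + (r + s) ≡ p + s + (q + r)
  regroup = solve-∀
  regroup′ : ∀ p q r s → p + q + (2 + r + s) ≡ (q + r) + (2 + s + p)
  regroup′ = solve-∀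
  regroup″ : ∀ p q r s → (p + q) + (2 + r + s) ≡ r + q + (2 + p + s)
  regroup″ = solve-∀
  regroup‴ : ∀ p q r s → p + q + (r + s) ≡ r + p + (q + s)
  regroup‴ = solve-∀

gapShift : ∀ {a a′} k p q →
           x (2 + a) ≡ 2 + k + p → x a ≡ k + q → p + x a′ ≡ x (2 + a′) + q → GapShift a a′
gapShift {a} {a′} k p q x[2+a] x[a] p+x[a′] = shift $ begin
  x (2 + a) + x a′          ≡⟨ cong (_+ x a′) x[2+a] ⟩
  2 + k + p + x a′          ≡⟨ +-assoc (2 + k) p (x a′) ⟩
  2 + k + (p + x a′)        ≡⟨ cong (2 + k +_) p+x[a′] ⟩
  2 + k + (x (2 + a′) + q)  ≡⟨ regroup k (x (2 + a′)) q ⟩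
  2 + x (2 + a′) + (k + q)  ≡⟨ cong (2 + x (2 + a′) +_) x[a] ⟨
  2 + x (2 + a′) + x a      ∎
  where
  open ≡-Reasoning
  regroup : ∀ k r q → 2 + k + (r + q) ≡ 2 + r + (k + q)
  regroup = solve-∀

gap[6+4j] : ∀ j → GapShift (6 + j * 4) (2 + j * 2)
gap[6+4j] j = gapShift (5 + j * 4) _ _ (x[8+4j] j) (x[6+4j] j) (+-assoc (x (4 + j * 2)) _ _)

gap[7+4j] : ∀ j → GapShift (7 + j * 4) (3 + j * 2)
gap[7+4j] j = gapShift (6 + j * 4) _ _ (x[9+4j] j) (x[7+4j] j) (double (x (5 + j * 2)) _)
  where
  double : ∀ d c → d + c + c ≡ d + 2 * c
  double = solve-∀

gap[8+4j] : ∀ j → GapShift (8 + j * 4) (3 + j * 2)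
gap[8+4j] j = gapShift (7 + j * 4) _ _ (x[6+4j] (suc j)) (x[8+4j] j) (+-assoc (x (5 + j * 2)) _ _)

gap[9+4j] : ∀ j → GapShift (9 + j * 4) (3 + j * 2)
gap[9+4j] j = gapShift (8 + j * 4) _ _ (x[7+4j] (suc j)) (x[9+4j] j) (double (x (5 + j * 2)) _)
  where
  double : ∀ d c → 2 * d + c ≡ d + (d + c)
  double = solve-∀

≼-suc : ∀ t → suc t ≼ suc (suc t)
≼-suc = <-rec (λ t → suc t ≼ suc (suc t)) go
  where
  go : ∀ t → (∀ {s} → s < t → suc s ≼ suc (suc s)) → suc t ≼ suc (suc t)
  go 0 _ = gap≤ (≤ᵇ⇒≤ _ _ _)
  go 1 _ = gap≤ (≤ᵇ⇒≤ _ _ _)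
  go 2 _ = gap≤ (≤ᵇ⇒≤ _ _ _)
  go 3 _ = gap≤ (≤ᵇ⇒≤ _ _ _)
  go 4 _ = gap≤ (≤ᵇ⇒≤ _ _ _)
  go (suc (suc (suc (suc (suc t))))) ih with t divMod 4
  ... | result j zero refl =
    ≼-transfer (gap[6+4j] j) (gap[7+4j] j)
               (ih (+-*2<+-*4 j (<ᵇ⇒< 1 5 _)))
  ... | result j (suc zero) refl =
    ≼-transfer (gap[7+4j] j) (gap[8+4j] j) ≼-refl
  ... | result j (suc (suc zero)) refl =
    ≼-transfer (gap[8+4j] j) (gap[9+4j] j) ≼-refl
  ... | result j (suc (suc (suc zero))) refl =
    ≼-transfer (gap[9+4j] j) (gap[6+4j] (suc j))
               (ih (+-*2<+-*4 j (<ᵇ⇒< 2 8 _)))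

≼-mono : ∀ {a b} → 1 ≤ a → a ≤ b → a ≼ b
≼-mono {a} 1≤a a≤b = go (≤⇒≤′ a≤b)
  where
  go : ∀ {b} → a ≤′ b → a ≼ b
  go ≤′-refl = ≼-refl
  go (≤′-step {suc t} a≤′t) = ≼-trans (go a≤′t) (≼-suc t)
  go (≤′-step {zero} a≤′0) = contradiction (≤-trans 1≤a (≤′⇒≤ a≤′0)) λ ()

lemma7 : (n i : ℕ) → n ≥ 3 → i ≤ n ∸ 3 →
    x (n + i) + x (n ∸ i ∸ 2) ≥ x (n + i ∸ 2) + x (n ∸ i)
lemma7 n i n≥3 i≤n∸3 =
  subst₂ (λ p q → x (n + i ∸ 2) + x p ≤ x q + x (n ∸ i ∸ 2))
         (m+[n∸m]≡n 2≤n∸i) (m+[n∸m]≡n 2≤n+i)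
         (_≼_.gap-≤ (≼-mono (∸-monoˡ-≤ 2 3≤n∸i) n∸i∸2≤n+i∸2))
  where
  3≤n∸i : 3 ≤ n ∸ i
  3≤n∸i = m+n≤o⇒m≤o∸n 3 (subst (_≤ n) (+-comm i 3) (m≤o∸n⇒m+n≤o i n≥3 i≤n∸3))
  2≤n∸i : 2 ≤ n ∸ i
  2≤n∸i = ≤-trans (n≤1+n 2) 3≤n∸i
  2≤n+i : 2 ≤ n + i
  2≤n+i = ≤-trans (n≤1+n 2) (≤-trans n≥3 (m≤m+n n i))
  n∸i∸2≤n+i∸2 : n ∸ i ∸ 2 ≤ n + i ∸ 2
  n∸i∸2≤n+i∸2 = ∸-monoˡ-≤ 2 (≤-trans (m∸n≤m n i) (m≤m+n n i))
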